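{- Let $G,H$ be finite-dimensional $\mathbb{F}_p$-vector spaces, $A \subseteq G$ and $F \colon A \to H$ a map. Let $r,s \in \mathbb{N}$, $\alpha>0$, and let $\lambda_{i,j} \in \mathbb{F}_p$ ($i\in [r], j \in [s]$) and $\mu_i \in \mathbb{F}_p$ ($i \in [r]$) be scalars. Assume that \[\sum_{i=1}^{r} \mu_i F\Big(\sum_{j=1}^{s} \lambda_{i,j} u_j\Big) = 0\] holds (with all arguments of $F$ lying in $A$) for at least $\alpha|G|^s$ $s$-tuples $(u_1, \dots, u_s) \in G^s$. Suppose there are distinct indices $a, b\in[s]$ and an index $i_0 \in [r]$ such that $\mu_{i_0} \neq 0$ and $\lambda_{i,a}\lambda_{i,b} \neq 0$ holds if and only if $i = i_0$. Then $F$ respects at least $\alpha^4 |G|^3$ additive quadruples in $A$.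
   Context: An additive quadruple in $A$ is $(x,y,z,w)\in A^4$ with $x+y=z+w$; $F$ respects it if $F(x)+F(y)=F(z)+F(w)$.
   Formalization: The parameter α ranges over the positive rationals. -}

module Defs where

open import Data.Nat using (ℕ; zero; suc; _+_; _*_; _^_; NonZero)
open import Data.Nat.DivMod using (_mod_)
open import Data.Fin using (Fin; toℕ; _≟_) renaming (zero to fz; suc to fs)
open import Data.Fin.Properties using (all?)
open import Data.Vec using (Vec; []; _∷_; zipWith; map; replicate)
open import Data.Vec.Properties using (≡-dec)
open import Data.List using (List; [_]; concatMap; length; filter; allFin) renaming (map to lmap)
open import Data.Bool using (Bool; true; _≟_)
open import Data.Product using (_×_; _,_)
open import Relation.Binary.PropositionalEquality using (_≡_)
open import Relation.Nullary using (Dec; _×-dec_)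
open import Relation.Unary using (Decidable)
open import Data.Integer using (+_)
open import Data.Rational using (ℚ; _/_)

ℕ→ℚ : ℕ → ℚ
ℕ→ℚ n = (+ n) / 1

count : {X : Set} {P : X → Set} → Decidable P → List X → ℕ
count P? xs = length (filter P? xs)

allVecs : {X : Set} → List X → (n : ℕ) → List (Vec X n)
allVecs xs zero = [ [] ]
allVecs xs (suc n) = concatMap (λ x → lmap (x ∷_) (allVecs xs n)) xs

-- The field F_p (p prime) modelled as Fin p with arithmetic mod p,
-- and the finite-dimensional F_p-vector space F_p^n modelled as Vec (Fin p) n.
module Fp (p : ℕ) .{{_ : NonZero p}} where

  𝔽 : Set
  𝔽 = Fin p

  0𝔽 : 𝔽
  0𝔽 = 0 mod p

  _+𝔽_ : 𝔽 → 𝔽 → 𝔽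
  x +𝔽 y = (toℕ x + toℕ y) mod p

  _*𝔽_ : 𝔽 → 𝔽 → 𝔽
  x *𝔽 y = (toℕ x * toℕ y) mod p

  V : ℕ → Set
  V n = Vec 𝔽 n

  0V : ∀ {n} → V n
  0V = replicate _ 0𝔽

  _+V_ : ∀ {n} → V n → V n → V n
  _+V_ = zipWith _+𝔽_

  _•_ : ∀ {n} → 𝔽 → V n → V n
  c • v = map (c *𝔽_) v

  ΣV : ∀ {n} (s : ℕ) → (Fin s → V n) → V n
  ΣV zero f = 0V
  ΣV (suc s) f = f fz +V ΣV s (λ j → f (fs j))

  allV : (n : ℕ) → List (V n)
  allV n = allVecs (allFin p) n

  card : ℕ → ℕ
  card n = p ^ n

  _≟V_ : ∀ {n} (x y : V n) → Dec (x ≡ y)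
  _≟V_ = ≡-dec Data.Fin._≟_

  module Setup {n m r s : ℕ} (A : V n → Bool) (F : V n → V m)
               (λ' : Fin r → Fin s → 𝔽) (μ : Fin r → 𝔽) where

    arg : Vec (V n) s → Fin r → V n
    arg u i = ΣV s (λ j → λ' i j • Data.Vec.lookup u j)

    Good : Vec (V n) s → Set
    Good u = (∀ i → A (arg u i) ≡ true) × (ΣV r (λ i → μ i • F (arg u i)) ≡ 0V)

    good? : Decidable Good
    good? u = all? (λ i → A (arg u i) Data.Bool.≟ true) ×-dec (ΣV r (λ i → μ i • F (arg u i)) ≟V 0V)

    #Good : ℕ
    #Good = count good? (allVecs (allV n) s)

  module Quad {n m : ℕ} (A : V n → Bool) (F : V n → V m) where

    Respected : V n × V n × V n × V n → Set
    Respected (x , y , z , w) =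
      (A x ≡ true × A y ≡ true × A z ≡ true × A w ≡ true)
      × (x +V y ≡ z +V w) × (F x +V F y ≡ F z +V F w)

    respected? : Decidable Respected
    respected? (x , y , z , w) =
      ((A x Data.Bool.≟ true) ×-dec (A y Data.Bool.≟ true) ×-dec (A z Data.Bool.≟ true) ×-dec (A w Data.Bool.≟ true))
      ×-dec ((x +V y) ≟V (z +V w)) ×-dec ((F x +V F y) ≟V (F z +V F w))

    allQuads : List (V n × V n × V n × V n)
    allQuads = concatMap (λ x → concatMap (λ y → concatMap (λ z → lmap (λ w → (x , y , z , w)) (allV n)) (allV n)) (allV n)) (allV n)

    #Respected : ℕ
    #Respected = count respected? allQuads

module Submission where

-- Fix all coordinates of u ∈ G^s except u_a = x and u_b = y, and let P(x,y) be the i₀-th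
-- argument Σ_j λ_{i₀,j} u_j. For i ≢ i₀ the i-th argument depends on at most one of x and y,
-- so if the four corners (x,y), (x',y'), (x,y'), (x',y) of a rectangle are solutions, subtracting
-- the equations of its two diagonals cancels every term with i ≢ i₀ and leaves
-- μ_{i₀} (F(P(x,y)) + F(P(x',y')) - F(P(x,y')) - F(P(x',y))) = 0. The four values of P form an
-- additive quadruple, and as λ_{i₀,a} λ_{i₀,b} ≠ 0 the quadruple together with x determines the
-- rectangle. Averaging over the remaining coordinates gives a slice with at least α|G|² solution
-- corners, and two applications of Cauchy–Schwarz give at least α⁴|G|⁴ solution rectangles in it,
-- hence at least α⁴|G|³ respected quadruples.

open import Defs
open import Data.Nat using (ℕ; NonZero)
open import Data.Nat.Primality using (Prime)
open import Data.Fin using (Fin)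
open import Data.Bool using (Bool)
open import Function.Bundles using (_⇔_)
open import Relation.Binary.PropositionalEquality using (_≡_; _≢_)

module FiniteSums where
  open import Data.Nat
  open import Data.Nat.Properties
  open import Data.Nat.Tactic.RingSolver using (solve-∀)
  open import Data.List using (List; []; _∷_; _++_; map; length; cartesianProductWith)
  open import Data.Product using (∃; _,_)
  open import Data.Sum using (inj₁; inj₂)
  open import Relation.Binary.PropositionalEquality
  open import Relation.Nullary using (yes; no)

  private variable
    X Y Z : Set

  ∑[_] : List X → (X → ℕ) → ℕ
  ∑[ [] ]     f = 0
  ∑[ x ∷ xs ] f = f x + ∑[ xs ] f

  ∑-cong : ∀ (xs : List X) {f g : X → ℕ} → (∀ x → f x ≡ g x) → ∑[ xs ] f ≡ ∑[ xs ] g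
  ∑-cong []       f≗g = refl
  ∑-cong (x ∷ xs) f≗g = cong₂ _+_ (f≗g x) (∑-cong xs f≗g)

  ∑-mono-≤ : ∀ (xs : List X) {f g : X → ℕ} → (∀ x → f x ≤ g x) → ∑[ xs ] f ≤ ∑[ xs ] g
  ∑-mono-≤ []       f≤g = z≤n
  ∑-mono-≤ (x ∷ xs) f≤g = +-mono-≤ (f≤g x) (∑-mono-≤ xs f≤g)

  ∑-++ : ∀ (xs ys : List X) f → ∑[ xs ++ ys ] f ≡ ∑[ xs ] f + ∑[ ys ] f
  ∑-++ []       ys f = refl
  ∑-++ (x ∷ xs) ys f = trans (cong (f x +_) (∑-++ xs ys f)) (sym (+-assoc (f x) _ _))

  ∑-map : ∀ (g : X → Y) xs f → ∑[ map g xs ] f ≡ ∑[ xs ] (λ x → f (g x))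
  ∑-map g []       f = refl
  ∑-map g (x ∷ xs) f = cong (f (g x) +_) (∑-map g xs f)

  ∑-cartesianProductWith : ∀ (h : X → Y → Z) xs ys f →
    ∑[ cartesianProductWith h xs ys ] f ≡ ∑[ xs ] (λ x → ∑[ ys ] (λ y → f (h x y)))
  ∑-cartesianProductWith h []       ys f = refl
  ∑-cartesianProductWith h (x ∷ xs) ys f =
    trans (∑-++ (map (h x) ys) _ f) (cong₂ _+_ (∑-map (h x) ys f) (∑-cartesianProductWith h xs ys f))

  ∑-const : ∀ (xs : List X) c → ∑[ xs ] (λ _ → c) ≡ length xs * c
  ∑-const []       c = refl
  ∑-const (x ∷ xs) c = cong (c +_) (∑-const xs c)

  ∑-distrib-+ : ∀ (xs : List X) f g → ∑[ xs ] (λ x → f x + g x) ≡ ∑[ xs ] f + ∑[ xs ] g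
  ∑-distrib-+ []       f g = refl
  ∑-distrib-+ (x ∷ xs) f g =
    trans (cong (f x + g x +_) (∑-distrib-+ xs f g)) (+-+-comm (f x) (g x) _ _)
    where
    +-+-comm : ∀ a b c d → a + b + (c + d) ≡ a + c + (b + d)
    +-+-comm = solve-∀

  *-distribˡ-∑ : ∀ (xs : List X) c f → c * ∑[ xs ] f ≡ ∑[ xs ] (λ x → c * f x)
  *-distribˡ-∑ []       c f = *-zeroʳ c
  *-distribˡ-∑ (x ∷ xs) c f = trans (*-distribˡ-+ c (f x) _) (cong (c * f x +_) (*-distribˡ-∑ xs c f))

  *-distribʳ-∑ : ∀ (xs : List X) c f → ∑[ xs ] f * c ≡ ∑[ xs ] (λ x → f x * c)
  *-distribʳ-∑ xs c f =
    trans (*-comm _ c) (trans (*-distribˡ-∑ xs c f) (∑-cong xs (λ x → *-comm c (f x))))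

  ∑-comm : ∀ (xs : List X) (ys : List Y) (f : X → Y → ℕ) →
    ∑[ xs ] (λ x → ∑[ ys ] (f x)) ≡ ∑[ ys ] (λ y → ∑[ xs ] (λ x → f x y))
  ∑-comm []       ys f = sym (trans (∑-const ys 0) (*-zeroʳ (length ys)))
  ∑-comm (x ∷ xs) ys f = trans (cong (∑[ ys ] (f x) +_) (∑-comm xs ys f)) (sym (∑-distrib-+ ys (f x) _))

  ∑*∑ : ∀ (xs : List X) (ys : List Y) f g →
    ∑[ xs ] f * ∑[ ys ] g ≡ ∑[ xs ] (λ x → ∑[ ys ] (λ y → f x * g y))
  ∑*∑ xs ys f g = trans (*-distribʳ-∑ xs _ f) (∑-cong xs (λ x → *-distribˡ-∑ ys (f x) g))

  ∑≤length*max : X → ∀ (xs : List X) f → ∃ λ m → ∑[ xs ] f ≤ length xs * f m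
  ∑≤length*max d []       f = d , z≤n
  ∑≤length*max d (x ∷ xs) f with ∑≤length*max d xs f
  ... | m , ∑≤ with f x ≤? f m
  ...   | yes fx≤fm = m , +-mono-≤ fx≤fm ∑≤
  ...   | no  fx≰fm = x , +-monoʳ-≤ (f x) (≤-trans ∑≤ (*-monoʳ-≤ (length xs) (<⇒≤ (≰⇒> fx≰fm))))

  private
    -- writing n = m + o, the difference of the two sides is o * o
    m≤n⇒m*n+m*n≤m*m+n*n : ∀ {m n} → m ≤ n → m * n + m * n ≤ m * m + n * n
    m≤n⇒m*n+m*n≤m*m+n*n {m} m≤n with m≤n⇒∃[o]m+o≡n m≤n
    ... | o , refl = subst (m * (m + o) + m * (m + o) ≤_) (identity m o) (m≤m+n _ (o * o))
      where
      identity : ∀ m o → m * (m + o) + m * (m + o) + o * o ≡ m * m + (m + o) * (m + o)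
      identity = solve-∀

  m*n+m*n≤m*m+n*n : ∀ m n → m * n + m * n ≤ m * m + n * n
  m*n+m*n≤m*m+n*n m n with ≤-total m n
  ... | inj₁ m≤n = m≤n⇒m*n+m*n≤m*m+n*n m≤n
  ... | inj₂ n≤m = subst₂ _≤_ (cong₂ _+_ (*-comm n m) (*-comm n m)) (+-comm (n * n) _) (m≤n⇒m*n+m*n≤m*m+n*n n≤m)

  cauchy-schwarz : ∀ (xs : List X) f → ∑[ xs ] f * ∑[ xs ] f ≤ length xs * ∑[ xs ] (λ x → f x * f x)
  cauchy-schwarz []       f = z≤n
  cauchy-schwarz (x ∷ xs) f = begin
      (a + S) * (a + S)                  ≡⟨ expand a S ⟩
      a * a + (a * S + a * S) + S * S    ≤⟨ +-mono-≤ (+-monoʳ-≤ (a * a) cross) (cauchy-schwarz xs f) ⟩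
      a * a + (n * (a * a) + T) + n * T  ≡⟨ collect a n T ⟩
      suc n * (a * a + T)                ∎
    where
    open ≤-Reasoning
    a = f x
    S = ∑[ xs ] f
    T = ∑[ xs ] (λ y → f y * f y)
    n = length xs
    expand : ∀ a S → (a + S) * (a + S) ≡ a * a + (a * S + a * S) + S * S
    expand = solve-∀
    collect : ∀ a n T → a * a + (n * (a * a) + T) + n * T ≡ suc n * (a * a + T)
    collect = solve-∀
    cross : a * S + a * S ≤ n * (a * a) + T
    cross = begin
      a * S + a * S                                      ≡⟨ cong₂ _+_ (*-distribˡ-∑ xs a f) (*-distribˡ-∑ xs a f) ⟩
      ∑[ xs ] (λ y → a * f y) + ∑[ xs ] (λ y → a * f y)  ≡⟨ ∑-distrib-+ xs _ _ ⟨
      ∑[ xs ] (λ y → a * f y + a * f y)                  ≤⟨ ∑-mono-≤ xs (λ y → m*n+m*n≤m*m+n*n a (f y)) ⟩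
      ∑[ xs ] (λ y → a * a + f y * f y)                  ≡⟨ ∑-distrib-+ xs _ _ ⟩
      ∑[ xs ] (λ _ → a * a) + T                          ≡⟨ cong (_+ T) (∑-const xs (a * a)) ⟩
      n * (a * a) + T                                    ∎

  box-inequality : ∀ (xs : List X) (ys : List Y) (S : X → Y → ℕ) →
    ∑[ xs ] (λ x → ∑[ ys ] (S x)) ^ 4 ≤ length xs ^ 2 * length ys ^ 2 *
      ∑[ xs ] (λ x → ∑[ xs ] (λ x' → ∑[ ys ] (λ y → ∑[ ys ] (λ y' → (S x y * S x' y) * (S x y' * S x' y')))))
  box-inequality {X = X} {Y = Y} xs ys S = begin
      β ^ 4                    ≡⟨ ^4≡ β ⟩
      (β * β) * (β * β)        ≤⟨ *-mono-≤ β²≤ β²≤ ⟩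
      (N * D) * (N * D)        ≡⟨ rearrange₁ N D ⟩
      (N * N) * (D * D)        ≤⟨ *-monoʳ-≤ (N * N) D²≤ ⟩
      (N * N) * (M * (M * C))  ≡⟨ rearrange₂ M N C ⟩
      M ^ 2 * N ^ 2 * C        ≡⟨ cong (M ^ 2 * N ^ 2 *_) C≡R ⟩
      M ^ 2 * N ^ 2 * R        ∎
    where
    open ≤-Reasoning
    M = length xs
    N = length ys
    β = ∑[ xs ] (λ x → ∑[ ys ] (S x))
    R = ∑[ xs ] (λ x → ∑[ xs ] (λ x' → ∑[ ys ] (λ y → ∑[ ys ] (λ y' → (S x y * S x' y) * (S x y' * S x' y')))))
    deg : Y → ℕ
    deg y = ∑[ xs ] (λ x → S x y)
    codeg : X → X → ℕ
    codeg x x' = ∑[ ys ] (λ y → S x y * S x' y)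
    D = ∑[ xs ] (λ x → ∑[ xs ] (codeg x))
    C = ∑[ xs ] (λ x → ∑[ xs ] (λ x' → codeg x x' * codeg x x'))
    ^4≡ : ∀ b → b * (b * (b * (b * 1))) ≡ (b * b) * (b * b)
    ^4≡ = solve-∀
    rearrange₁ : ∀ n d → (n * d) * (n * d) ≡ (n * n) * (d * d)
    rearrange₁ = solve-∀
    rearrange₂ : ∀ m n c → (n * n) * (m * (m * c)) ≡ m * (m * 1) * (n * (n * 1)) * c
    rearrange₂ = solve-∀
    β²≤ : β * β ≤ N * D
    β²≤ = begin
      β * β                                ≡⟨ cong₂ _*_ (∑-comm xs ys S) (∑-comm xs ys S) ⟩
      ∑[ ys ] deg * ∑[ ys ] deg            ≤⟨ cauchy-schwarz ys deg ⟩
      N * ∑[ ys ] (λ y → deg y * deg y)    ≡⟨ cong (N *_) ∑deg²≡D ⟩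
      N * D                                ∎
      where
      ∑deg²≡D : ∑[ ys ] (λ y → deg y * deg y) ≡ D
      ∑deg²≡D = trans (∑-cong ys (λ y → ∑*∑ xs xs (λ x → S x y) (λ x' → S x' y)))
               (trans (∑-comm ys xs _) (∑-cong xs (λ x → ∑-comm ys xs _)))
    D²≤ : D * D ≤ M * (M * C)
    D²≤ = begin
      D * D
        ≤⟨ cauchy-schwarz xs _ ⟩
      M * ∑[ xs ] (λ x → ∑[ xs ] (codeg x) * ∑[ xs ] (codeg x))
        ≤⟨ *-monoʳ-≤ M (∑-mono-≤ xs (λ x → cauchy-schwarz xs (codeg x))) ⟩
      M * ∑[ xs ] (λ x → M * ∑[ xs ] (λ x' → codeg x x' * codeg x x'))
        ≡⟨ cong (M *_) (*-distribˡ-∑ xs M _) ⟨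
      M * (M * C)
        ∎
    C≡R : C ≡ R
    C≡R = ∑-cong xs (λ x → ∑-cong xs (λ x' → ∑*∑ ys ys _ _))

module Counting where
  open import Data.Nat
  open import Data.Nat.Properties
  open import Data.List using (List; []; _∷_; _++_; map; length; filter; cartesianProductWith; cartesianProduct)
  open import Data.List.Properties using (length-map; length-++)
  open import Data.List.Membership.Propositional using (_∈_)
  open import Data.List.Membership.Propositional.Properties using (∈-map⁻; ∈-filter⁺; ∈-filter⁻; ∈-∃++; ∈-++⁻; ∈-++⁺ˡ; ∈-++⁺ʳ)
  open import Data.List.Relation.Binary.Subset.Propositional using (_⊆_)
  open import Data.List.Relation.Unary.Any using (here; there)
  import Data.List.Relation.Unary.All as All
  open import Data.List.Relation.Unary.AllPairs using (_∷_)
  open import Data.List.Relation.Unary.Unique.Propositional using (Unique)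
  open import Data.List.Relation.Unary.Unique.Propositional.Properties using (map⁺; filter⁺)
  open import Data.Product using (_×_; _,_; proj₁; proj₂)
  open import Data.Sum using (inj₁; inj₂)
  open import Relation.Binary.PropositionalEquality
  open import Relation.Nullary using (Dec; yes; no; _×-dec_; contradiction)
  open import Relation.Unary using (Pred; Decidable)
  open FiniteSums

  private variable
    A B X Y Z : Set
    P : Pred X _
    Q : Pred Y _

  𝟙 : Dec A → ℕ
  𝟙 (yes _) = 1
  𝟙 (no _)  = 0

  𝟙-×-dec : (a : Dec A) (b : Dec B) → 𝟙 (a ×-dec b) ≡ 𝟙 a * 𝟙 b
  𝟙-×-dec (yes _) (yes _) = refl
  𝟙-×-dec (yes _) (no _)  = refl
  𝟙-×-dec (no _)  _       = refl

  count≡∑𝟙 : (P? : Decidable P) (xs : List X) → count P? xs ≡ ∑[ xs ] (λ x → 𝟙 (P? x))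
  count≡∑𝟙 P? []       = refl
  count≡∑𝟙 P? (x ∷ xs) with P? x
  ... | yes _ = cong suc (count≡∑𝟙 P? xs)
  ... | no _  = count≡∑𝟙 P? xs

  length-cartesianProductWith : ∀ (h : X → Y → Z) xs ys →
    length (cartesianProductWith h xs ys) ≡ length xs * length ys
  length-cartesianProductWith h []       ys = refl
  length-cartesianProductWith h (x ∷ xs) ys = trans (length-++ (map (h x) ys))
    (cong₂ _+_ (length-map (h x) ys) (length-cartesianProductWith h xs ys))

  count-cartesianProduct : (P? : Decidable P) (xs : List X) (ys : List Y) →
    count (λ xy → P? (proj₁ xy)) (cartesianProduct xs ys) ≡ count P? xs * length ys
  count-cartesianProduct P? xs ys = begin
    count (λ xy → P? (proj₁ xy)) (cartesianProduct xs ys)  ≡⟨ count≡∑𝟙 _ (cartesianProduct xs ys) ⟩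
    ∑[ cartesianProduct xs ys ] (λ xy → 𝟙 (P? (proj₁ xy)))  ≡⟨ ∑-cartesianProductWith _,_ xs ys _ ⟩
    ∑[ xs ] (λ x → ∑[ ys ] (λ _ → 𝟙 (P? x)))
      ≡⟨ ∑-cong xs (λ x → trans (∑-const ys _) (*-comm (length ys) _)) ⟩
    ∑[ xs ] (λ x → 𝟙 (P? x) * length ys)                     ≡⟨ *-distribʳ-∑ xs (length ys) _ ⟨
    ∑[ xs ] (λ x → 𝟙 (P? x)) * length ys                     ≡⟨ cong (_* length ys) (count≡∑𝟙 P? xs) ⟨
    count P? xs * length ys                                   ∎
    where open ≡-Reasoning

  length-mono-⊆ : {xs ys : List X} → Unique xs → xs ⊆ ys → length xs ≤ length ys
  length-mono-⊆ {xs = []}     _             _     = z≤n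
  length-mono-⊆ {xs = x ∷ xs} (x∉xs ∷ !xs) x∷xs⊆ys with ∈-∃++ (x∷xs⊆ys (here refl))
  ... | zs₁ , zs₂ , refl = begin
      suc (length xs)                ≤⟨ s≤s (length-mono-⊆ !xs xs⊆zs₁++zs₂) ⟩
      suc (length (zs₁ ++ zs₂))      ≡⟨ cong suc (length-++ zs₁) ⟩
      suc (length zs₁ + length zs₂)  ≡⟨ +-suc (length zs₁) _ ⟨
      length zs₁ + suc (length zs₂)  ≡⟨ length-++ zs₁ ⟨
      length (zs₁ ++ x ∷ zs₂)        ∎
    where
    open ≤-Reasoning
    xs⊆zs₁++zs₂ : xs ⊆ zs₁ ++ zs₂
    xs⊆zs₁++zs₂ y∈xs with ∈-++⁻ zs₁ (x∷xs⊆ys (there y∈xs))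
    ... | inj₁ y∈zs₁          = ∈-++⁺ˡ y∈zs₁
    ... | inj₂ (here refl)    = contradiction refl (All.lookup x∉xs y∈xs)
    ... | inj₂ (there y∈zs₂)  = ∈-++⁺ʳ zs₁ y∈zs₂

  count-≤-injection : (P? : Decidable P) (Q? : Decidable Q) {xs : List X} {ys : List Y}
    (f : X → Y) → (∀ {x x'} → f x ≡ f x' → x ≡ x') → (∀ {x} → P x → Q (f x)) →
    Unique xs → (∀ y → y ∈ ys) → count P? xs ≤ count Q? ys
  count-≤-injection P? Q? {xs} {ys} f f-injective f-pres !xs ys-complete = begin
    count P? xs                    ≡⟨ length-map f (filter P? xs) ⟨
    length (map f (filter P? xs))  ≤⟨ length-mono-⊆ (map⁺ f-injective (filter⁺ P? !xs)) image⊆ ⟩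
    count Q? ys                    ∎
    where
    open ≤-Reasoning
    image⊆ : map f (filter P? xs) ⊆ filter Q? ys
    image⊆ y∈ with ∈-map⁻ f y∈
    ... | x , x∈ , refl = ∈-filter⁺ Q? (ys-complete (f x)) (f-pres (proj₂ (∈-filter⁻ P? {xs = xs} x∈)))

module Enumeration where
  open import Data.Nat using (zero; suc; _*_; _^_)
  open import Data.List using (List; []; _∷_; _++_; map; length; concatMap; cartesianProductWith)
  open import Data.List.Membership.Propositional using (_∈_)
  open import Data.List.Membership.Propositional.Properties using (∈-cartesianProductWith⁺)
  open import Data.List.Relation.Unary.Any using (here)
  open import Data.List.Relation.Unary.All using ([])
  open import Data.List.Relation.Unary.AllPairs using ([]; _∷_)
  open import Data.List.Relation.Unary.Unique.Propositional using (Unique)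
  open import Data.List.Relation.Unary.Unique.Propositional.Properties using (cartesianProductWith⁺)
  open import Data.Vec using (Vec; []; _∷_)
  open import Data.Vec.Properties using (∷-injective)
  open import Relation.Binary.PropositionalEquality
  open Counting using (length-cartesianProductWith)

  private variable
    X Y Z : Set

  private
    concatMap-map≡cartesianProductWith : ∀ (h : X → Y → Z) xs ys →
      concatMap (λ x → map (h x) ys) xs ≡ cartesianProductWith h xs ys
    concatMap-map≡cartesianProductWith h []       ys = refl
    concatMap-map≡cartesianProductWith h (x ∷ xs) ys =
      cong (map (h x) ys ++_) (concatMap-map≡cartesianProductWith h xs ys)

  allVecs-suc : ∀ (xs : List X) n → allVecs xs (suc n) ≡ cartesianProductWith _∷_ xs (allVecs xs n)
  allVecs-suc xs n = concatMap-map≡cartesianProductWith _∷_ xs (allVecs xs n)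

  allVecs-unique : ∀ {xs : List X} → Unique xs → ∀ n → Unique (allVecs xs n)
  allVecs-unique !xs zero                 = [] ∷ []
  allVecs-unique {xs = xs} !xs (suc n) =
    subst Unique (sym (allVecs-suc xs n)) (cartesianProductWith⁺ _∷_ ∷-injective !xs (allVecs-unique !xs n))

  ∈-allVecs : ∀ {xs : List X} → (∀ x → x ∈ xs) → ∀ n (v : Vec X n) → v ∈ allVecs xs n
  ∈-allVecs complete zero    []                 = here refl
  ∈-allVecs {xs = xs} complete (suc n) (x ∷ v) =
    subst (x ∷ v ∈_) (sym (allVecs-suc xs n)) (∈-cartesianProductWith⁺ _∷_ (complete x) (∈-allVecs complete n v))

  length-allVecs : ∀ (xs : List X) n → length (allVecs xs n) ≡ length xs ^ n
  length-allVecs xs zero    = refl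
  length-allVecs xs (suc n) = begin
    length (allVecs xs (suc n))                              ≡⟨ cong length (allVecs-suc xs n) ⟩
    length (cartesianProductWith _∷_ xs (allVecs xs n))      ≡⟨ length-cartesianProductWith _∷_ xs _ ⟩
    length xs * length (allVecs xs n)                        ≡⟨ cong (length xs *_) (length-allVecs xs n) ⟩
    length xs * length xs ^ n                                ∎
    where open ≡-Reasoning

module PrimeField (p : ℕ) .{{_ : NonZero p}} (p-prime : Prime p) where
  open import Data.Nat using (zero; suc; _+_; _*_; _∸_; >-nonZero⁻¹)
  open import Data.Nat.Properties using (+-comm; +-assoc; *-distribˡ-+; *-zeroʳ; m+[n∸m]≡n; <⇒≤)
  open import Data.Nat.DivMod using (_%_; _mod_; m%n<n; m%n%n≡m%n; %-distribˡ-+; %-distribˡ-*; m<n⇒m%n≡m; n%n≡0)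
  open import Data.Nat.Divisibility using (_∣_; n∣m⇒m%n≡0; m%n≡0⇒n∣m)
  open import Data.Nat.Primality using (euclidsLemma)
  open import Data.Fin using (zero; suc; toℕ)
  open import Data.Fin.Properties using (toℕ-fromℕ<; toℕ-injective; toℕ<n; suc-injective)
  open import Data.Sum using (_⊎_; inj₁; inj₂)
  open import Data.Vec using ([]; _∷_)
  open import Data.Vec.Properties using (∷-injective; map-cong; map-const)
  open import Data.Vec.Relation.Binary.Pointwise.Inductive using (Pointwise-≡⇒≡; zipWith-comm; zipWith-assoc; zipWith-identityˡ)
  open import Data.Product using (_,_)
  open import Relation.Binary.PropositionalEquality
  open import Relation.Nullary using (contradiction)
  open ≡-Reasoning
  open Fp p

  private
    toℕ-mod : ∀ m → toℕ (m mod p) ≡ m % p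
    toℕ-mod m = toℕ-fromℕ< (m%n<n m p)

    mod-cong : ∀ {m n} → m % p ≡ n % p → m mod p ≡ n mod p
    mod-cong e = toℕ-injective (trans (toℕ-mod _) (trans e (sym (toℕ-mod _))))

    toℕ-% : ∀ x → toℕ x % p ≡ toℕ x
    toℕ-% x = m<n⇒m%n≡m (toℕ<n x)

    %-absorbˡ : ∀ m n → (m % p + n) % p ≡ (m + n) % p
    %-absorbˡ m n = begin
      (m % p + n) % p           ≡⟨ %-distribˡ-+ (m % p) n p ⟩
      (m % p % p + n % p) % p   ≡⟨ cong (λ k → (k + n % p) % p) (m%n%n≡m%n m p) ⟩
      (m % p + n % p) % p       ≡⟨ %-distribˡ-+ m n p ⟨
      (m + n) % p               ∎

    %-absorbʳ : ∀ m n → (m + n % p) % p ≡ (m + n) % p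
    %-absorbʳ m n = begin
      (m + n % p) % p  ≡⟨ cong (_% p) (+-comm m _) ⟩
      (n % p + m) % p  ≡⟨ %-absorbˡ n m ⟩
      (n + m) % p      ≡⟨ cong (_% p) (+-comm n m) ⟩
      (m + n) % p      ∎

    %-absorbʳ-* : ∀ m n → (m * (n % p)) % p ≡ (m * n) % p
    %-absorbʳ-* m n = begin
      (m * (n % p)) % p          ≡⟨ %-distribˡ-* m (n % p) p ⟩
      (m % p * (n % p % p)) % p  ≡⟨ cong (λ k → (m % p * k) % p) (m%n%n≡m%n n p) ⟩
      (m % p * (n % p)) % p      ≡⟨ %-distribˡ-* m n p ⟨
      (m * n) % p                ∎

    toℕ-0𝔽 : toℕ 0𝔽 ≡ 0
    toℕ-0𝔽 = trans (toℕ-mod 0) (m<n⇒m%n≡m (>-nonZero⁻¹ p))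

    p∣⇒≡0𝔽 : ∀ x → p ∣ toℕ x → x ≡ 0𝔽
    p∣⇒≡0𝔽 x p∣x = toℕ-injective (begin
      toℕ x      ≡⟨ toℕ-% x ⟨
      toℕ x % p  ≡⟨ n∣m⇒m%n≡0 _ p p∣x ⟩
      0          ≡⟨ toℕ-0𝔽 ⟨
      toℕ 0𝔽     ∎)

  infix 25 -𝔽_
  -𝔽_ : 𝔽 → 𝔽
  -𝔽 x = (p ∸ toℕ x) mod p

  +𝔽-comm : ∀ x y → x +𝔽 y ≡ y +𝔽 x
  +𝔽-comm x y = cong (_mod p) (+-comm (toℕ x) (toℕ y))

  +𝔽-assoc : ∀ x y z → (x +𝔽 y) +𝔽 z ≡ x +𝔽 (y +𝔽 z)
  +𝔽-assoc x y z = mod-cong (begin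
    (toℕ (x +𝔽 y) + toℕ z) % p            ≡⟨ cong (λ k → (k + toℕ z) % p) (toℕ-mod _) ⟩
    ((toℕ x + toℕ y) % p + toℕ z) % p     ≡⟨ %-absorbˡ _ _ ⟩
    (toℕ x + toℕ y + toℕ z) % p           ≡⟨ cong (_% p) (+-assoc (toℕ x) _ _) ⟩
    (toℕ x + (toℕ y + toℕ z)) % p         ≡⟨ %-absorbʳ _ _ ⟨
    (toℕ x + (toℕ y + toℕ z) % p) % p     ≡⟨ cong (λ k → (toℕ x + k) % p) (toℕ-mod _) ⟨
    (toℕ x + toℕ (y +𝔽 z)) % p            ∎)

  +𝔽-identityˡ : ∀ x → 0𝔽 +𝔽 x ≡ x
  +𝔽-identityˡ x = toℕ-injective (begin
    toℕ (0𝔽 +𝔽 x)           ≡⟨ toℕ-mod _ ⟩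
    (toℕ 0𝔽 + toℕ x) % p    ≡⟨ cong (λ k → (k + toℕ x) % p) toℕ-0𝔽 ⟩
    toℕ x % p               ≡⟨ toℕ-% x ⟩
    toℕ x                   ∎)

  +𝔽-identityʳ : ∀ x → x +𝔽 0𝔽 ≡ x
  +𝔽-identityʳ x = trans (+𝔽-comm x 0𝔽) (+𝔽-identityˡ x)

  +𝔽-inverseʳ : ∀ x → x +𝔽 -𝔽 x ≡ 0𝔽
  +𝔽-inverseʳ x = mod-cong (begin
    (toℕ x + toℕ (-𝔽 x)) % p        ≡⟨ cong (λ k → (toℕ x + k) % p) (toℕ-mod _) ⟩
    (toℕ x + (p ∸ toℕ x) % p) % p   ≡⟨ %-absorbʳ _ _ ⟩
    (toℕ x + (p ∸ toℕ x)) % p       ≡⟨ cong (_% p) (m+[n∸m]≡n (<⇒≤ (toℕ<n x))) ⟩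
    p % p                           ≡⟨ n%n≡0 p ⟩
    0                               ≡⟨ m<n⇒m%n≡m (>-nonZero⁻¹ p) ⟨
    0 % p                           ∎)

  +𝔽-cancelʳ : ∀ x y c → x +𝔽 c ≡ y +𝔽 c → x ≡ y
  +𝔽-cancelʳ x y c e = begin
    x                     ≡⟨ +𝔽-identityʳ x ⟨
    x +𝔽 0𝔽               ≡⟨ cong (x +𝔽_) (+𝔽-inverseʳ c) ⟨
    x +𝔽 (c +𝔽 -𝔽 c)      ≡⟨ +𝔽-assoc x c _ ⟨
    (x +𝔽 c) +𝔽 -𝔽 c      ≡⟨ cong (_+𝔽 -𝔽 c) e ⟩
    (y +𝔽 c) +𝔽 -𝔽 c      ≡⟨ +𝔽-assoc y c _ ⟩
    y +𝔽 (c +𝔽 -𝔽 c)      ≡⟨ cong (y +𝔽_) (+𝔽-inverseʳ c) ⟩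
    y +𝔽 0𝔽               ≡⟨ +𝔽-identityʳ y ⟩
    y                     ∎

  *𝔽-distribˡ-+𝔽 : ∀ c x y → c *𝔽 (x +𝔽 y) ≡ (c *𝔽 x) +𝔽 (c *𝔽 y)
  *𝔽-distribˡ-+𝔽 c x y = mod-cong (begin
    (toℕ c * toℕ (x +𝔽 y)) % p                  ≡⟨ cong (λ k → (toℕ c * k) % p) (toℕ-mod _) ⟩
    (toℕ c * ((toℕ x + toℕ y) % p)) % p         ≡⟨ %-absorbʳ-* (toℕ c) _ ⟩
    (toℕ c * (toℕ x + toℕ y)) % p               ≡⟨ cong (_% p) (*-distribˡ-+ (toℕ c) _ _) ⟩
    (toℕ c * toℕ x + toℕ c * toℕ y) % p         ≡⟨ %-absorbˡ _ _ ⟨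
    ((toℕ c * toℕ x) % p + toℕ c * toℕ y) % p   ≡⟨ %-absorbʳ _ _ ⟨
    ((toℕ c * toℕ x) % p + (toℕ c * toℕ y) % p) % p
      ≡⟨ cong₂ (λ k l → (k + l) % p) (toℕ-mod _) (toℕ-mod _) ⟨
    (toℕ (c *𝔽 x) + toℕ (c *𝔽 y)) % p           ∎)

  *𝔽-zeroˡ : ∀ x → 0𝔽 *𝔽 x ≡ 0𝔽
  *𝔽-zeroˡ x = mod-cong (cong (λ k → (k * toℕ x) % p) toℕ-0𝔽)

  *𝔽-zeroʳ : ∀ x → x *𝔽 0𝔽 ≡ 0𝔽
  *𝔽-zeroʳ x = mod-cong (trans (cong (λ k → (toℕ x * k) % p) toℕ-0𝔽) (cong (_% p) (*-zeroʳ (toℕ x))))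

  *𝔽-zero⁻¹ : ∀ c d → c *𝔽 d ≡ 0𝔽 → c ≡ 0𝔽 ⊎ d ≡ 0𝔽
  *𝔽-zero⁻¹ c d cd≡0 with euclidsLemma (toℕ c) (toℕ d) p-prime (m%n≡0⇒n∣m _ p (begin
    (toℕ c * toℕ d) % p  ≡⟨ toℕ-mod _ ⟨
    toℕ (c *𝔽 d)         ≡⟨ cong toℕ cd≡0 ⟩
    toℕ 0𝔽               ≡⟨ toℕ-0𝔽 ⟩
    0                    ∎))
  ... | inj₁ p∣c = inj₁ (p∣⇒≡0𝔽 c p∣c)
  ... | inj₂ p∣d = inj₂ (p∣⇒≡0𝔽 d p∣d)

  *𝔽-cancelˡ : ∀ c x y → c ≢ 0𝔽 → c *𝔽 x ≡ c *𝔽 y → x ≡ y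
  *𝔽-cancelˡ c x y c≢0 e with *𝔽-zero⁻¹ c (x +𝔽 (-𝔽 y)) (begin
    c *𝔽 (x +𝔽 (-𝔽 y))              ≡⟨ *𝔽-distribˡ-+𝔽 c x _ ⟩
    (c *𝔽 x) +𝔽 (c *𝔽 (-𝔽 y))       ≡⟨ cong (_+𝔽 (c *𝔽 (-𝔽 y))) e ⟩
    (c *𝔽 y) +𝔽 (c *𝔽 (-𝔽 y))       ≡⟨ *𝔽-distribˡ-+𝔽 c y _ ⟨
    c *𝔽 (y +𝔽 (-𝔽 y))              ≡⟨ cong (c *𝔽_) (+𝔽-inverseʳ y) ⟩
    c *𝔽 0𝔽                         ≡⟨ *𝔽-zeroʳ c ⟩
    0𝔽                              ∎)
  ... | inj₁ c≡0   = contradiction c≡0 c≢0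
  ... | inj₂ x-y≡0 = +𝔽-cancelʳ x y (-𝔽 y) (trans x-y≡0 (sym (+𝔽-inverseʳ y)))

  +V-comm : ∀ {k} (v w : V k) → v +V w ≡ w +V v
  +V-comm v w = Pointwise-≡⇒≡ (zipWith-comm +𝔽-comm v w)

  +V-assoc : ∀ {k} (u v w : V k) → (u +V v) +V w ≡ u +V (v +V w)
  +V-assoc u v w = Pointwise-≡⇒≡ (zipWith-assoc +𝔽-assoc u v w)

  +V-identityˡ : ∀ {k} (v : V k) → 0V +V v ≡ v
  +V-identityˡ v = Pointwise-≡⇒≡ (zipWith-identityˡ +𝔽-identityˡ v)

  +V-cancelʳ : ∀ {k} (v w c : V k) → v +V c ≡ w +V c → v ≡ w
  +V-cancelʳ []      []      []      _ = refl
  +V-cancelʳ (x ∷ v) (y ∷ w) (z ∷ c) e with ∷-injective e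
  ... | e₁ , e₂ = cong₂ _∷_ (+𝔽-cancelʳ x y z e₁) (+V-cancelʳ v w c e₂)

  +V-cancelˡ : ∀ {k} (c v w : V k) → c +V v ≡ c +V w → v ≡ w
  +V-cancelˡ c v w e = +V-cancelʳ v w c (trans (+V-comm v c) (trans e (+V-comm c w)))

  +V-interchange : ∀ {k} (u v w z : V k) → (u +V v) +V (w +V z) ≡ (u +V w) +V (v +V z)
  +V-interchange u v w z = begin
    (u +V v) +V (w +V z)  ≡⟨ +V-assoc u v _ ⟩
    u +V (v +V (w +V z))  ≡⟨ cong (u +V_) (+V-assoc v w z) ⟨
    u +V ((v +V w) +V z)  ≡⟨ cong (λ t → u +V (t +V z)) (+V-comm v w) ⟩
    u +V ((w +V v) +V z)  ≡⟨ cong (u +V_) (+V-assoc w v z) ⟩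
    u +V (w +V (v +V z))  ≡⟨ +V-assoc u w _ ⟨
    (u +V w) +V (v +V z)  ∎

  •-distribˡ-+V : ∀ {k} c (v w : V k) → c • (v +V w) ≡ (c • v) +V (c • w)
  •-distribˡ-+V c []      []      = refl
  •-distribˡ-+V c (x ∷ v) (y ∷ w) = cong₂ _∷_ (*𝔽-distribˡ-+𝔽 c x y) (•-distribˡ-+V c v w)

  •-zeroˡ : ∀ {k} (v : V k) → 0𝔽 • v ≡ 0V
  •-zeroˡ v = trans (map-cong *𝔽-zeroˡ v) (map-const v 0𝔽)

  •-cancelˡ : ∀ {k} c (v w : V k) → c ≢ 0𝔽 → c • v ≡ c • w → v ≡ w
  •-cancelˡ c []      []      _   _ = refl
  •-cancelˡ c (x ∷ v) (y ∷ w) c≢0 e with ∷-injective e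
  ... | e₁ , e₂ = cong₂ _∷_ (*𝔽-cancelˡ c x y c≢0 e₁) (•-cancelˡ c v w c≢0 e₂)

  ΣV-cong : ∀ {k} s {f g : Fin s → V k} → (∀ j → f j ≡ g j) → ΣV s f ≡ ΣV s g
  ΣV-cong zero    f≗g = refl
  ΣV-cong (suc s) f≗g = cong₂ _+V_ (f≗g zero) (ΣV-cong s (λ j → f≗g (suc j)))

  ΣV-distrib-+V : ∀ {k} s (f g : Fin s → V k) → ΣV s (λ j → f j +V g j) ≡ ΣV s f +V ΣV s g
  ΣV-distrib-+V zero    f g = sym (+V-identityˡ 0V)
  ΣV-distrib-+V (suc s) f g = trans (cong ((f zero +V g zero) +V_) (ΣV-distrib-+V s (λ j → f (suc j)) (λ j → g (suc j))))
                                    (+V-interchange (f zero) (g zero) _ _)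

  ΣV-cancel : ∀ {k} s (f g : Fin s → V k) j₀ → ΣV s f ≡ ΣV s g → (∀ j → j ≢ j₀ → f j ≡ g j) → f j₀ ≡ g j₀
  ΣV-cancel (suc s) f g zero     ∑f≡∑g f≗g = +V-cancelʳ (f zero) (g zero) _
    (trans ∑f≡∑g (cong (g zero +V_) (ΣV-cong s (λ j → sym (f≗g (suc j) λ ())))))
  ΣV-cancel (suc s) f g (suc j₀) ∑f≡∑g f≗g = ΣV-cancel s (λ j → f (suc j)) (λ j → g (suc j)) j₀
    (+V-cancelˡ (f zero) _ _ (trans ∑f≡∑g (cong (_+V ΣV s (λ j → g (suc j))) (sym (f≗g zero λ ())))))
    (λ j j≢j₀ → f≗g (suc j) (λ e → j≢j₀ (suc-injective e)))

module TwoCoordinates {A : Set} {s : ℕ} (a b : Fin s) (a≢b : a ≢ b) where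
  open import Data.Fin using (_≟_)
  open import Data.Vec using (Vec; lookup; _[_]≔_)
  open import Data.Vec.Properties using (lookup∘update; lookup∘update′; []≔-commutes; []≔-idempotent; []≔-lookup)
  open import Function using (_∘_)
  open import Relation.Binary.PropositionalEquality
  open import Relation.Nullary using (yes; no)

  infixl 6 _⟨_,_⟩
  _⟨_,_⟩ : Vec A s → A → A → Vec A s
  u ⟨ x , y ⟩ = (u [ a ]≔ x) [ b ]≔ y

  lookup-a : ∀ u x y → lookup (u ⟨ x , y ⟩) a ≡ x
  lookup-a u x y = trans (lookup∘update′ a≢b (u [ a ]≔ x) y) (lookup∘update a u x)

  lookup-b : ∀ u x y → lookup (u ⟨ x , y ⟩) b ≡ y
  lookup-b u x y = lookup∘update b (u [ a ]≔ x) y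

  lookup-other : ∀ u x y {j} → j ≢ a → j ≢ b → lookup (u ⟨ x , y ⟩) j ≡ lookup u j
  lookup-other u x y j≢a j≢b = trans (lookup∘update′ j≢b (u [ a ]≔ x) y) (lookup∘update′ j≢a u x)

  lookup-≢a : ∀ u x x' y {j} → j ≢ a → lookup (u ⟨ x , y ⟩) j ≡ lookup (u ⟨ x' , y ⟩) j
  lookup-≢a u x x' y {j} j≢a with j ≟ b
  ... | yes refl = trans (lookup-b u x y) (sym (lookup-b u x' y))
  ... | no j≢b   = trans (lookup-other u x y j≢a j≢b) (sym (lookup-other u x' y j≢a j≢b))

  lookup-≢b : ∀ u x y y' {j} → j ≢ b → lookup (u ⟨ x , y ⟩) j ≡ lookup (u ⟨ x , y' ⟩) j
  lookup-≢b u x y y' {j} j≢b with j ≟ a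
  ... | yes refl = trans (lookup-a u x y) (sym (lookup-a u x y'))
  ... | no j≢a   = trans (lookup-other u x y j≢a j≢b) (sym (lookup-other u x y' j≢a j≢b))

  lookup-rectangle : (_∙_ : A → A → A) → (∀ x y → x ∙ y ≡ y ∙ x) → ∀ u x x' y y' j →
    lookup (u ⟨ x , y ⟩) j ∙ lookup (u ⟨ x' , y' ⟩) j ≡ lookup (u ⟨ x , y' ⟩) j ∙ lookup (u ⟨ x' , y ⟩) j
  lookup-rectangle _∙_ ∙-comm u x x' y y' j with j ≟ a | j ≟ b
  ... | yes refl | _        rewrite lookup-a u x y | lookup-a u x' y' | lookup-a u x y' | lookup-a u x' y = refl
  ... | no j≢a   | yes refl rewrite lookup-b u x y | lookup-b u x' y' | lookup-b u x y' | lookup-b u x' y = ∙-comm y y'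
  ... | no j≢a   | no j≢b   rewrite lookup-other u x y j≢a j≢b | lookup-other u x' y' j≢a j≢b
                                  | lookup-other u x y' j≢a j≢b | lookup-other u x' y j≢a j≢b = refl

  ⟨⟩-restore : ∀ u x y → u ⟨ x , y ⟩ ⟨ lookup u a , lookup u b ⟩ ≡ u
  ⟨⟩-restore u x y = begin
    (((u [ a ]≔ x) [ b ]≔ y) [ a ]≔ lookup u a) [ b ]≔ lookup u b
      ≡⟨ cong (_[ b ]≔ lookup u b) ([]≔-commutes (u [ a ]≔ x) b a (a≢b ∘ sym)) ⟩
    (((u [ a ]≔ x) [ a ]≔ lookup u a) [ b ]≔ y) [ b ]≔ lookup u b
      ≡⟨ []≔-idempotent ((u [ a ]≔ x) [ a ]≔ lookup u a) b ⟩
    ((u [ a ]≔ x) [ a ]≔ lookup u a) [ b ]≔ lookup u b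
      ≡⟨ cong (_[ b ]≔ lookup u b) (trans ([]≔-idempotent u a) ([]≔-lookup u a)) ⟩
    u [ b ]≔ lookup u b
      ≡⟨ []≔-lookup u b ⟩
    u ∎
    where open ≡-Reasoning

module NatToRational where
  open import Data.Nat as ℕ using (ℕ; _^_)
  import Data.Nat.Properties as ℕ
  open import Data.Nat.Tactic.RingSolver using (solve-∀)
  import Data.Integer as ℤ
  import Data.Integer.Properties as ℤ
  open import Data.Rational
  open import Data.Rational.Properties
  import Data.Rational.Unnormalised as ℚᵘ
  import Data.Rational.Unnormalised.Properties as ℚᵘ
  open import Data.Rational.Solver using (module +-*-Solver)
  open +-*-Solver using (solve; _:*_; _:=_)
  open import Relation.Binary.PropositionalEquality

  private
    ℕ→ℚᵘ : ℕ → ℚᵘ.ℚᵘ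
    ℕ→ℚᵘ n = ℚᵘ.mkℚᵘ (ℤ.+ n) 0

    toℚᵘ-ℕ→ℚ : ∀ n → toℚᵘ (ℕ→ℚ n) ℚᵘ.≃ ℕ→ℚᵘ n
    toℚᵘ-ℕ→ℚ n = toℚᵘ-fromℚᵘ (ℕ→ℚᵘ n)

    ℤ+n*1≡+n : ∀ n → ℤ.+ n ℤ.* ℤ.+ 1 ≡ ℤ.+ n
    ℤ+n*1≡+n n = ℤ.*-identityʳ (ℤ.+ n)

  ℕ→ℚ-* : ∀ m n → ℕ→ℚ (m ℕ.* n) ≡ ℕ→ℚ m * ℕ→ℚ n
  ℕ→ℚ-* m n = toℚᵘ-injective (ℚᵘ.≃-trans (toℚᵘ-ℕ→ℚ (m ℕ.* n)) (ℚᵘ.≃-trans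
    (ℚᵘ.*≡* (cong (ℤ._* ℤ.+ 1) (ℤ.pos-* m n)))
    (ℚᵘ.≃-sym (ℚᵘ.≃-trans (toℚᵘ-homo-* (ℕ→ℚ m) (ℕ→ℚ n)) (ℚᵘ.*-cong (toℚᵘ-ℕ→ℚ m) (toℚᵘ-ℕ→ℚ n))))))

  ℕ→ℚ-mono-≤ : ∀ {m n} → m ℕ.≤ n → ℕ→ℚ m ≤ ℕ→ℚ n
  ℕ→ℚ-mono-≤ {m} {n} m≤n = toℚᵘ-cancel-≤
    (ℚᵘ.≤-respˡ-≃ (ℚᵘ.≃-sym (toℚᵘ-ℕ→ℚ m)) (ℚᵘ.≤-respʳ-≃ (ℚᵘ.≃-sym (toℚᵘ-ℕ→ℚ n))
    (ℚᵘ.*≤* (subst₂ ℤ._≤_ (sym (ℤ+n*1≡+n m)) (sym (ℤ+n*1≡+n n)) (ℤ.+≤+ m≤n)))))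

  ℕ→ℚ-pos : ∀ {n} → 0 ℕ.< n → Positive (ℕ→ℚ n)
  ℕ→ℚ-pos {n} 0<n = positive (toℚᵘ-cancel-< (ℚᵘ.<-respʳ-≃ (ℚᵘ.≃-sym (toℚᵘ-ℕ→ℚ n))
    (ℚᵘ.*<* (subst (ℤ.+ 0 ℤ.<_) (sym (ℤ+n*1≡+n n)) (ℤ.+<+ 0<n)))))

  ℕ→ℚ-^4 : ∀ n → ℕ→ℚ (n ^ 4) ≡ (ℕ→ℚ n * ℕ→ℚ n) * (ℕ→ℚ n * ℕ→ℚ n)
  ℕ→ℚ-^4 n = begin
    ℕ→ℚ (n ^ 4)                               ≡⟨ cong ℕ→ℚ (n^4≡ n) ⟩
    ℕ→ℚ ((n ℕ.* n) ℕ.* (n ℕ.* n))             ≡⟨ ℕ→ℚ-* (n ℕ.* n) _ ⟩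
    ℕ→ℚ (n ℕ.* n) * ℕ→ℚ (n ℕ.* n)             ≡⟨ cong₂ _*_ (ℕ→ℚ-* n n) (ℕ→ℚ-* n n) ⟩
    (ℕ→ℚ n * ℕ→ℚ n) * (ℕ→ℚ n * ℕ→ℚ n)        ∎
    where
    open ≡-Reasoning
    n^4≡ : ∀ n → n ℕ.* (n ℕ.* (n ℕ.* (n ℕ.* 1))) ≡ (n ℕ.* n) ℕ.* (n ℕ.* n)
    n^4≡ = solve-∀

  0≤x≤y⇒x*x≤y*y : ∀ {x y} → 0ℚ ≤ x → x ≤ y → x * x ≤ y * y
  0≤x≤y⇒x*x≤y*y {x} {y} 0≤x x≤y = ≤-trans (*-monoˡ-≤-nonNeg x {{nonNegative 0≤x}} x≤y)
                                         (*-monoʳ-≤-nonNeg y {{nonNegative (≤-trans 0≤x x≤y)}} x≤y)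

  α⁴-bound : ∀ (α : ℚ) (K N G Q : ℕ) → 0ℚ < α → 0 ℕ.< K → 0 ℕ.< N → α * ℕ→ℚ K ≤ ℕ→ℚ G →
    (G ℕ.* (N ℕ.* N)) ^ 4 ℕ.≤ K ^ 4 ℕ.* (N ^ 4 ℕ.* (Q ℕ.* N)) →
    α * α * α * α * ℕ→ℚ (N ^ 3) ≤ ℕ→ℚ Q
  α⁴-bound α K N G Q 0<α 0<K 0<N αK≤G bound = *-cancelʳ-≤-pos w {{w-pos}} (begin
      α * α * α * α * ℕ→ℚ (N ^ 3) * w  ≡⟨ cong (λ t → α * α * α * α * t * w) N³ ⟩
      α * α * α * α * (n * (n * n)) * w ≡⟨ expand α k n ⟩
      (x * x) * (x * x)                 ≤⟨ 0≤x≤y⇒x*x≤y*y (0≤ (x * x) {{x*x-pos}}) (0≤x≤y⇒x*x≤y*y (0≤ x) x≤y) ⟩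
      (y * y) * (y * y)                 ≡⟨ ℕ→ℚ-^4 (G ℕ.* (N ℕ.* N)) ⟨
      ℕ→ℚ ((G ℕ.* (N ℕ.* N)) ^ 4)       ≤⟨ ℕ→ℚ-mono-≤ bound ⟩
      ℕ→ℚ (K ^ 4 ℕ.* (N ^ 4 ℕ.* (Q ℕ.* N)))
        ≡⟨ trans (ℕ→ℚ-* (K ^ 4) _)
             (cong₂ _*_ (ℕ→ℚ-^4 K) (trans (ℕ→ℚ-* (N ^ 4) _) (cong₂ _*_ (ℕ→ℚ-^4 N) (ℕ→ℚ-* Q N)))) ⟩
      ((k * k) * (k * k)) * (((n * n) * (n * n)) * (q * n)) ≡⟨ collect k n q ⟩
      q * w                             ∎)
    where
    open ≤-Reasoning
    k = ℕ→ℚ K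
    n = ℕ→ℚ N
    q = ℕ→ℚ Q
    w = ((k * k) * (k * k)) * (((n * n) * (n * n)) * n)
    x = α * k * (n * n)
    y = ℕ→ℚ (G ℕ.* (N ℕ.* N))
    0≤ : ∀ r .{{_ : Positive r}} → 0ℚ ≤ r
    0≤ r = <⇒≤ (positive⁻¹ r)
    pos*pos : ∀ r t → Positive r → Positive t → Positive (r * t)
    pos*pos r t r-pos t-pos = pos*pos⇒pos r {{r-pos}} t {{t-pos}}
    k-pos : Positive k
    k-pos = ℕ→ℚ-pos 0<K
    n-pos : Positive n
    n-pos = ℕ→ℚ-pos 0<N
    n²-pos : Positive (n * n)
    n²-pos = pos*pos n n n-pos n-pos
    k²-pos : Positive (k * k)
    k²-pos = pos*pos k k k-pos k-pos
    instance
      x-pos : Positive x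
      x-pos = pos*pos (α * k) (n * n) (pos*pos α k (positive 0<α) k-pos) n²-pos
    x*x-pos : Positive (x * x)
    x*x-pos = pos*pos x x x-pos x-pos
    w-pos : Positive w
    w-pos = pos*pos ((k * k) * (k * k)) (((n * n) * (n * n)) * n) (pos*pos (k * k) (k * k) k²-pos k²-pos)
              (pos*pos ((n * n) * (n * n)) n (pos*pos (n * n) (n * n) n²-pos n²-pos) n-pos)
    N³ : ℕ→ℚ (N ^ 3) ≡ n * (n * n)
    N³ = trans (ℕ→ℚ-* N _) (cong (n *_) (trans (ℕ→ℚ-* N _) (cong (λ t → n * ℕ→ℚ t) (ℕ.*-identityʳ N))))
    x≤y : x ≤ y
    x≤y = ≤-trans (*-monoʳ-≤-nonNeg (n * n) {{pos⇒nonNeg (n * n) {{n²-pos}}}} αK≤G)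
      (≤-reflexive (sym (trans (ℕ→ℚ-* G _) (cong (ℕ→ℚ G *_) (ℕ→ℚ-* N N)))))
    expand : ∀ α k n → α * α * α * α * (n * (n * n)) * (((k * k) * (k * k)) * (((n * n) * (n * n)) * n))
                     ≡ (α * k * (n * n) * (α * k * (n * n))) * (α * k * (n * n) * (α * k * (n * n)))
    expand = solve 3 (λ α k n →
      α :* α :* α :* α :* (n :* (n :* n)) :* (((k :* k) :* (k :* k)) :* (((n :* n) :* (n :* n)) :* n))
        := (α :* k :* (n :* n) :* (α :* k :* (n :* n))) :* (α :* k :* (n :* n) :* (α :* k :* (n :* n)))) refl
    collect : ∀ k n q → ((k * k) * (k * k)) * (((n * n) * (n * n)) * (q * n))
                      ≡ q * (((k * k) * (k * k)) * (((n * n) * (n * n)) * n))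
    collect = solve 3 (λ k n q →
      ((k :* k) :* (k :* k)) :* (((n :* n) :* (n :* n)) :* (q :* n))
        := q :* (((k :* k) :* (k :* k)) :* (((n :* n) :* (n :* n)) :* n))) refl

module Rectangles (p : ℕ) .{{_ : NonZero p}} (p-prime : Prime p) {n m r s : ℕ}
    (A : Fp.V p n → Bool) (F : Fp.V p n → Fp.V p m) (λ' : Fin r → Fin s → Fp.𝔽 p) (μ : Fin r → Fp.𝔽 p)
    (a b : Fin s) (a≢b : a ≢ b) (i₀ : Fin r) (μi₀≢0 : μ i₀ ≢ Fp.0𝔽 p)
    (λ-support : ∀ i → (Fp._*𝔽_ p (λ' i a) (λ' i b) ≢ Fp.0𝔽 p) ⇔ (i ≡ i₀)) where

  open import Data.Nat using (_*_; _^_; _≤_)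
  open import Data.Nat.Properties using (*-monoʳ-≤; ^-monoˡ-≤; ^-distribˡ-+-*; ≤-trans; module ≤-Reasoning)
  open import Data.Fin using (_≟_)
  open import Data.Nat.Tactic.RingSolver using (solve-∀)
  open import Data.Vec using (Vec; lookup; replicate)
  open import Data.List using (List; length; cartesianProduct; allFin)
  open import Data.List.Properties using (length-tabulate)
  open import Data.List.Membership.Propositional using (_∈_; lose)
  open import Data.List.Membership.Propositional.Properties using (∈-cartesianProduct⁺; ∈-allFin; ∈-map⁺; ∈-concatMap⁺)
  open import Data.List.Relation.Unary.Unique.Propositional using (Unique)
  open import Data.List.Relation.Unary.Unique.Propositional.Properties using (cartesianProduct⁺; allFin⁺)
  open import Data.Product using (_×_; _,_; proj₁; proj₂)
  open import Data.Sum using (_⊎_; inj₁; inj₂)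
  open import Function using (id)
  open import Function.Bundles using (Equivalence)
  open import Relation.Binary.PropositionalEquality
  open import Relation.Nullary using (Dec; yes; no; _×-dec_; contradiction)
  open Fp p
  open PrimeField p p-prime
  open Setup A F λ' μ
  open Quad A F
  open TwoCoordinates {V n} a b a≢b
  open FiniteSums
  open Counting
  open Enumeration

  G : Set
  G = V n

  corner : Vec G s → Fin r → G → G → G
  corner u i x y = arg (u ⟨ x , y ⟩) i

  corner-rectangle : ∀ u i x x' y y' →
    corner u i x y +V corner u i x' y' ≡ corner u i x y' +V corner u i x' y
  corner-rectangle u i x x' y y' = begin
    corner u i x y +V corner u i x' y'                       ≡⟨ ΣV-distrib-+V s _ _ ⟨
    ΣV s (λ j → term x y j +V term x' y' j)                   ≡⟨ ΣV-cong s termwise ⟩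
    ΣV s (λ j → term x y' j +V term x' y j)                   ≡⟨ ΣV-distrib-+V s _ _ ⟩
    corner u i x y' +V corner u i x' y                       ∎
    where
    open ≡-Reasoning
    term : G → G → Fin s → G
    term x y j = λ' i j • lookup (u ⟨ x , y ⟩) j
    termwise : ∀ j → term x y j +V term x' y' j ≡ term x y' j +V term x' y j
    termwise j = begin
      term x y j +V term x' y' j                                    ≡⟨ •-distribˡ-+V (λ' i j) _ _ ⟨
      λ' i j • (lookup (u ⟨ x , y ⟩) j +V lookup (u ⟨ x' , y' ⟩) j)
        ≡⟨ cong (λ' i j •_) (lookup-rectangle _+V_ +V-comm u x x' y y' j) ⟩
      λ' i j • (lookup (u ⟨ x , y' ⟩) j +V lookup (u ⟨ x' , y ⟩) j) ≡⟨ •-distribˡ-+V (λ' i j) _ _ ⟩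
      term x y' j +V term x' y j                                    ∎

  corner-ignores-x : ∀ u i x x' y → λ' i a ≡ 0𝔽 → corner u i x y ≡ corner u i x' y
  corner-ignores-x u i x x' y λia≡0 = ΣV-cong s termwise
    where
    termwise : ∀ j → λ' i j • lookup (u ⟨ x , y ⟩) j ≡ λ' i j • lookup (u ⟨ x' , y ⟩) j
    termwise j with j ≟ a
    ... | yes refl rewrite λia≡0 = trans (•-zeroˡ _) (sym (•-zeroˡ _))
    ... | no j≢a = cong (λ' i j •_) (lookup-≢a u x x' y j≢a)

  corner-ignores-y : ∀ u i x y y' → λ' i b ≡ 0𝔽 → corner u i x y ≡ corner u i x y'
  corner-ignores-y u i x y y' λib≡0 = ΣV-cong s termwise
    where
    termwise : ∀ j → λ' i j • lookup (u ⟨ x , y ⟩) j ≡ λ' i j • lookup (u ⟨ x , y' ⟩) j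
    termwise j with j ≟ b
    ... | yes refl rewrite λib≡0 = trans (•-zeroˡ _) (sym (•-zeroˡ _))
    ... | no j≢b = cong (λ' i j •_) (lookup-≢b u x y y' j≢b)

  corner-injective-x : ∀ u i x x' y → λ' i a ≢ 0𝔽 → corner u i x y ≡ corner u i x' y → x ≡ x'
  corner-injective-x u i x x' y λia≢0 eq = •-cancelˡ (λ' i a) x x' λia≢0
    (subst₂ (λ v w → λ' i a • v ≡ λ' i a • w) (lookup-a u x y) (lookup-a u x' y)
      (ΣV-cancel s _ _ a eq (λ j j≢a → cong (λ' i j •_) (lookup-≢a u x x' y j≢a))))

  corner-injective-y : ∀ u i x y y' → λ' i b ≢ 0𝔽 → corner u i x y ≡ corner u i x y' → y ≡ y'
  corner-injective-y u i x y y' λib≢0 eq = •-cancelˡ (λ' i b) y y' λib≢0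
    (subst₂ (λ v w → λ' i b • v ≡ λ' i b • w) (lookup-b u x y) (lookup-b u x y')
      (ΣV-cancel s _ _ b eq (λ j j≢b → cong (λ' i j •_) (lookup-≢b u x y y' j≢b))))

  λi₀a≢0 : λ' i₀ a ≢ 0𝔽
  λi₀a≢0 λi₀a≡0 = Equivalence.from (λ-support i₀) refl
    (trans (cong (_*𝔽 λ' i₀ b) λi₀a≡0) (*𝔽-zeroˡ (λ' i₀ b)))

  λi₀b≢0 : λ' i₀ b ≢ 0𝔽
  λi₀b≢0 λi₀b≡0 = Equivalence.from (λ-support i₀) refl
    (trans (cong (λ' i₀ a *𝔽_) λi₀b≡0) (*𝔽-zeroʳ (λ' i₀ a)))

  λ-vanishes : ∀ i → i ≢ i₀ → λ' i a ≡ 0𝔽 ⊎ λ' i b ≡ 0𝔽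
  λ-vanishes i i≢i₀ with (λ' i a *𝔽 λ' i b) ≟ 0𝔽
  ... | yes λiaλib≡0 = *𝔽-zero⁻¹ _ _ λiaλib≡0
  ... | no  λiaλib≢0 = contradiction (Equivalence.to (λ-support i) λiaλib≢0) i≢i₀

  Rectangle : Vec G s → G × G × G × G → Set
  Rectangle u (x , x' , y , y') =
    (Good (u ⟨ x , y ⟩) × Good (u ⟨ x' , y ⟩)) × (Good (u ⟨ x , y' ⟩) × Good (u ⟨ x' , y' ⟩))

  rectangle? : ∀ u q → Dec (Rectangle u q)
  rectangle? u (x , x' , y , y') =
    (good? (u ⟨ x , y ⟩) ×-dec good? (u ⟨ x' , y ⟩)) ×-dec (good? (u ⟨ x , y' ⟩) ×-dec good? (u ⟨ x' , y' ⟩))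

  quadruple : Vec G s → G × G × G × G → G × G × G × G
  quadruple u (x , x' , y , y') = corner u i₀ x y , corner u i₀ x' y' , corner u i₀ x y' , corner u i₀ x' y

  F-respects-diagonals : ∀ u x x' y y' → Good (u ⟨ x , y ⟩) → Good (u ⟨ x' , y' ⟩) →
    Good (u ⟨ x , y' ⟩) → Good (u ⟨ x' , y ⟩) →
    F (corner u i₀ x y) +V F (corner u i₀ x' y') ≡ F (corner u i₀ x y') +V F (corner u i₀ x' y)
  F-respects-diagonals u x x' y y' (_ , Σxy≡0) (_ , Σx'y'≡0) (_ , Σxy'≡0) (_ , Σx'y≡0) =
    •-cancelˡ (μ i₀) _ _ μi₀≢0 (trans (•-distribˡ-+V (μ i₀) _ _)
      (trans (ΣV-cancel r diagonal antidiagonal i₀ (trans Σdiagonal≡0 (sym Σantidiagonal≡0)) off-i₀)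
        (sym (•-distribˡ-+V (μ i₀) _ _))))
    where
    W : Fin r → G → G → V m
    W i x y = μ i • F (corner u i x y)
    diagonal antidiagonal : Fin r → V m
    diagonal i = W i x y +V W i x' y'
    antidiagonal i = W i x y' +V W i x' y
    Σdiagonal≡0 : ΣV r diagonal ≡ 0V +V 0V
    Σdiagonal≡0 = trans (ΣV-distrib-+V r _ _) (cong₂ _+V_ Σxy≡0 Σx'y'≡0)
    Σantidiagonal≡0 : ΣV r antidiagonal ≡ 0V +V 0V
    Σantidiagonal≡0 = trans (ΣV-distrib-+V r _ _) (cong₂ _+V_ Σxy'≡0 Σx'y≡0)
    off-i₀ : ∀ i → i ≢ i₀ → diagonal i ≡ antidiagonal i
    off-i₀ i i≢i₀ with λ-vanishes i i≢i₀
    ... | inj₁ λia≡0 rewrite corner-ignores-x u i x x' y λia≡0 | corner-ignores-x u i x' x y' λia≡0 = +V-comm _ _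
    ... | inj₂ λib≡0 rewrite corner-ignores-y u i x y y' λib≡0 | corner-ignores-y u i x' y' y λib≡0 = refl

  rectangle⇒respected : ∀ u q → Rectangle u q → Respected (quadruple u q)
  rectangle⇒respected u (x , x' , y , y') ((gxy , gx'y) , (gxy' , gx'y')) =
    (proj₁ gxy i₀ , proj₁ gx'y' i₀ , proj₁ gxy' i₀ , proj₁ gx'y i₀) ,
    corner-rectangle u i₀ x x' y y' ,
    F-respects-diagonals u x x' y y' gxy gx'y' gxy' gx'y

  quadruple-injective : ∀ u {q q'} → (quadruple u q , proj₁ q) ≡ (quadruple u q' , proj₁ q') → q ≡ q'
  quadruple-injective u {x , x' , y , y'} {_ , x₂' , y₂ , y₂'} eq with cong proj₂ eq
  ... | refl = cong (x ,_) (cong₂ _,_ x'≡x₂' (cong₂ _,_ y≡y₂ y'≡y₂'))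
    where
    y≡y₂ : y ≡ y₂
    y≡y₂ = corner-injective-y u i₀ x y y₂ λi₀b≢0 (cong (λ t → proj₁ (proj₁ t)) eq)
    y'≡y₂' : y' ≡ y₂'
    y'≡y₂' = corner-injective-y u i₀ x y' y₂' λi₀b≢0 (cong (λ t → proj₁ (proj₂ (proj₂ (proj₁ t)))) eq)
    x'≡x₂' : x' ≡ x₂'
    x'≡x₂' = corner-injective-x u i₀ x' x₂' y λi₀a≢0
      (trans (cong (λ t → proj₂ (proj₂ (proj₂ (proj₁ t)))) eq) (cong (corner u i₀ x₂') (sym y≡y₂)))

  E : List G
  E = allV n

  N : ℕ
  N = length E

  E-unique : Unique E
  E-unique = allVecs-unique (allFin⁺ p) n

  ∈-E : ∀ x → x ∈ E
  ∈-E = ∈-allVecs ∈-allFin n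

  N≡card : N ≡ card n
  N≡card = trans (length-allVecs (allFin p) n) (cong (_^ n) (length-tabulate id))

  Us : List (Vec G s)
  Us = allVecs E s

  edge : Vec G s → G → G → ℕ
  edge u x y = 𝟙 (good? (u ⟨ x , y ⟩))

  #edges : Vec G s → ℕ
  #edges u = ∑[ E ] (λ x → ∑[ E ] (edge u x))

  -- Every solution v is the corner (v_a , v_b) of the slice through v.
  recentre : Vec G s × G × G → Vec G s × G × G
  recentre (v , x , y) = v ⟨ x , y ⟩ , lookup v a , lookup v b

  recentre-involutive : ∀ t → recentre (recentre t) ≡ t
  recentre-involutive (v , x , y) =
    cong₂ _,_ (⟨⟩-restore v x y) (cong₂ _,_ (lookup-a v x y) (lookup-b v x y))

  #Good*N²≤∑#edges : #Good * (N * N) ≤ ∑[ Us ] #edges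
  #Good*N²≤∑#edges = begin
    #Good * (N * N)                         ≡⟨ cong (#Good *_) (length-cartesianProductWith _,_ E E) ⟨
    #Good * length (cartesianProduct E E)   ≡⟨ count-cartesianProduct good? Us _ ⟨
    count (λ t → good? (proj₁ t)) slices    ≤⟨ count-≤-injection _ corner-good? recentre recentre-injective
                                                 (λ {t} → good⇒corner-good t) slices-unique ∈-slices ⟩
    count corner-good? slices               ≡⟨ count≡∑𝟙 corner-good? slices ⟩
    ∑[ slices ] (λ t → 𝟙 (corner-good? t))  ≡⟨ trans (∑-cartesianProductWith _,_ Us _ _)
                                                 (∑-cong Us (λ v → ∑-cartesianProductWith _,_ E E _)) ⟩
    ∑[ Us ] #edges                          ∎
    where
    open ≤-Reasoning
    slices : List (Vec G s × G × G)
    slices = cartesianProduct Us (cartesianProduct E E)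
    slices-unique : Unique slices
    slices-unique = cartesianProduct⁺ (allVecs-unique E-unique s) (cartesianProduct⁺ E-unique E-unique)
    ∈-slices : ∀ t → t ∈ slices
    ∈-slices (v , x , y) = ∈-cartesianProduct⁺ (∈-allVecs ∈-E s v) (∈-cartesianProduct⁺ (∈-E x) (∈-E y))
    CornerGood : Vec G s × G × G → Set
    CornerGood (v , x , y) = Good (v ⟨ x , y ⟩)
    corner-good? : ∀ t → Dec (CornerGood t)
    corner-good? (v , x , y) = good? (v ⟨ x , y ⟩)
    recentre-injective : ∀ {t t'} → recentre t ≡ recentre t' → t ≡ t'
    recentre-injective {t} {t'} eq =
      trans (sym (recentre-involutive t)) (trans (cong recentre eq) (recentre-involutive t'))
    good⇒corner-good : ∀ t → Good (proj₁ t) → CornerGood (recentre t)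
    good⇒corner-good (v , x , y) = subst Good (sym (⟨⟩-restore v x y))

  E⁴ : List (G × G × G × G)
  E⁴ = cartesianProduct E (cartesianProduct E (cartesianProduct E E))

  #rectangles : Vec G s → ℕ
  #rectangles u = count (rectangle? u) E⁴

  #rectangles≡∑ : ∀ u → #rectangles u ≡
    ∑[ E ] (λ x → ∑[ E ] (λ x' → ∑[ E ] (λ y → ∑[ E ] (λ y' →
      (edge u x y * edge u x' y) * (edge u x y' * edge u x' y')))))
  #rectangles≡∑ u = trans (count≡∑𝟙 (rectangle? u) E⁴)
    (trans (∑-cartesianProductWith _,_ E _ _) (∑-cong E λ x →
      trans (∑-cartesianProductWith _,_ E _ _) (∑-cong E λ x' →
        trans (∑-cartesianProductWith _,_ E E _) (∑-cong E λ y → ∑-cong E λ y' → 𝟙-rectangle x x' y y'))))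
    where
    𝟙-rectangle : ∀ x x' y y' →
      𝟙 (rectangle? u (x , x' , y , y')) ≡ (edge u x y * edge u x' y) * (edge u x y' * edge u x' y')
    𝟙-rectangle x x' y y' = trans (𝟙-×-dec (good? (u ⟨ x , y ⟩) ×-dec good? (u ⟨ x' , y ⟩)) _)
      (cong₂ _*_ (𝟙-×-dec (good? (u ⟨ x , y ⟩)) _) (𝟙-×-dec (good? (u ⟨ x , y' ⟩)) _))

  #rectangles≤ : ∀ u → #rectangles u ≤ #Respected * N
  #rectangles≤ u = begin
    #rectangles u                                 ≤⟨ count-≤-injection (rectangle? u) (λ t → respected? (proj₁ t))
                                                       (λ q → quadruple u q , proj₁ q) (quadruple-injective u)
                                                       (λ {q} → rectangle⇒respected u q) E⁴-unique ∈-allQuads×E ⟩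
    count (λ t → respected? (proj₁ t)) (cartesianProduct allQuads E) ≡⟨ count-cartesianProduct respected? allQuads E ⟩
    #Respected * N                                ∎
    where
    open ≤-Reasoning
    E⁴-unique : Unique E⁴
    E⁴-unique = cartesianProduct⁺ E-unique (cartesianProduct⁺ E-unique (cartesianProduct⁺ E-unique E-unique))
    ∈-allQuads×E : ∀ t → t ∈ cartesianProduct allQuads E
    ∈-allQuads×E ((x , y , z , w) , x') = ∈-cartesianProduct⁺
      (∈-concatMap⁺ _ (lose (∈-E x) (∈-concatMap⁺ _ (lose (∈-E y) (∈-concatMap⁺ _ (lose (∈-E z) (∈-map⁺ _ (∈-E w))))))))
      (∈-E x')

  fourth-power-bound : (#Good * (N * N)) ^ 4 ≤ (N ^ s) ^ 4 * (N ^ 4 * (#Respected * N))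
  fourth-power-bound with ∑≤length*max (replicate s 0V) Us #edges
  ... | u , ∑≤ = begin
    (#Good * (N * N)) ^ 4                  ≤⟨ ^-monoˡ-≤ 4 (≤-trans #Good*N²≤∑#edges ∑#edges≤) ⟩
    (N ^ s * #edges u) ^ 4                 ≡⟨ ^4-distrib (N ^ s) (#edges u) ⟩
    (N ^ s) ^ 4 * #edges u ^ 4             ≤⟨ *-monoʳ-≤ ((N ^ s) ^ 4) box ⟩
    (N ^ s) ^ 4 * (N ^ 4 * #rectangles u)  ≤⟨ *-monoʳ-≤ ((N ^ s) ^ 4) (*-monoʳ-≤ (N ^ 4) (#rectangles≤ u)) ⟩
    (N ^ s) ^ 4 * (N ^ 4 * (#Respected * N)) ∎
    where
    open ≤-Reasoning
    ∑#edges≤ : ∑[ Us ] #edges ≤ N ^ s * #edges u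
    ∑#edges≤ = subst (λ k → ∑[ Us ] #edges ≤ k * #edges u) (length-allVecs E s) ∑≤
    box : #edges u ^ 4 ≤ N ^ 4 * #rectangles u
    box = subst₂ (λ k l → #edges u ^ 4 ≤ k * l) (sym (^-distribˡ-+-* N 2 2)) (sym (#rectangles≡∑ u))
      (box-inequality E E (edge u))
    ^4-distrib : ∀ k b → (k * b) * ((k * b) * ((k * b) * ((k * b) * 1)))
                       ≡ (k * (k * (k * (k * 1)))) * (b * (b * (b * (b * 1))))
    ^4-distrib = solve-∀

  solutions-bound : (#Good * (card n * card n)) ^ 4 ≤ (card n ^ s) ^ 4 * (card n ^ 4 * (#Respected * card n))
  solutions-bound =
    subst (λ N → (#Good * (N * N)) ^ 4 ≤ (N ^ s) ^ 4 * (N ^ 4 * (#Respected * N))) N≡card fourth-power-bound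

open import Defs
open import Data.Nat using (ℕ; NonZero; _^_)
open import Data.Nat.Primality using (Prime)
open import Data.Fin using (Fin)
open import Data.Vec using (Vec)
open import Data.Bool using (Bool)
open import Data.Product using (_×_)
open import Relation.Binary.PropositionalEquality using (_≡_; _≢_)
open import Function.Bundles using (_⇔_)
open import Data.Rational using (ℚ; 0ℚ; _<_; _≤_; _*_)
open import Data.Nat.Properties using (m^n>0; m^n≢0)

lemma6p2 : (p : ℕ) .{{_ : NonZero p}} → Prime p →
    (n m : ℕ) → (A : Fp.V p n → Bool) → (F : Fp.V p n → Fp.V p m) →
    (r s : ℕ) → (α : ℚ) → 0ℚ < α →
    (λ' : Fin r → Fin s → Fp.𝔽 p) → (μ : Fin r → Fp.𝔽 p) →
    α * ℕ→ℚ (Fp.card p n ^ s) ≤ ℕ→ℚ (Fp.Setup.#Good p A F λ' μ) →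
    (a b : Fin s) → a ≢ b → (i₀ : Fin r) → μ i₀ ≢ Fp.0𝔽 p →
    (∀ i → (Fp._*𝔽_ p (λ' i a) (λ' i b) ≢ Fp.0𝔽 p) ⇔ (i ≡ i₀)) →
    α * α * α * α * ℕ→ℚ (Fp.card p n ^ 3) ≤ ℕ→ℚ (Fp.Quad.#Respected p A F)
lemma6p2 p p-prime n m A F r s α 0<α λ' μ αK≤#Good a b a≢b i₀ μi₀≢0 λ-support =
  NatToRational.α⁴-bound α (Fp.card p n ^ s) (Fp.card p n) (Fp.Setup.#Good p A F λ' μ) (Fp.Quad.#Respected p A F)
    0<α (m^n>0 (p ^ n) {{m^n≢0 p n}} s) (m^n>0 p n) αK≤#Good
    (Rectangles.solutions-bound p p-prime A F λ' μ a b a≢b i₀ μi₀≢0 λ-support)
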